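{- For an integer $b$, let $T(b)=\sum_{i=0}^{\lfloor b/2\rfloor}(-1)^i(b-2i)^{b-3}\binom{b}{i}$. Then $T(b)\ne0$ for every integer $b\ge5$. -}

module Defs where

open import Data.Nat using (ℕ; zero; suc; _∸_; _/_)
open import Data.Nat.Combinatorics using (_C_)
open import Data.Integer using (ℤ; +_; _*_; _^_) renaming (_+_ to _+ℤ_; -_ to -ℤ_)
open import Data.List using (List; map; upTo; foldr)

sign : ℕ → ℤ
sign i = (-ℤ (+ 1)) ^ i

-- the i-th term: (-1)^i (b - 2i)^(b-3) binom(b,i)
-- (for 0 ≤ i ≤ ⌊b/2⌋ we have 2i ≤ b, so b ∸ 2i is the true difference;
--  for b ≥ 5, b ∸ 3 is the true exponent b - 3)
term : ℕ → ℕ → ℤ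
term b i = sign i * ((+ (b ∸ (2 Data.Nat.* i))) ^ (b ∸ 3)) * (+ (b C i))

sumℤ : List ℤ → ℤ
sumℤ = foldr _+ℤ_ (+ 0)

T : ℕ → ℤ
T b = sumℤ (map (term b) (upTo (suc (b / 2))))

module Submission where

-- Write Δ n k y = Σ_{i ≤ n} (-1)^i C(n,i) (y ∸ 2i)^k: the n-th backward
-- difference, with step 2, of x ↦ x^k at y, with bases truncated at 0.
-- The terms of T(b) with i > b/2 vanish, so T(b) = Δ b (b-3) b.
--
-- Two recurrences drive the proof: Pascal's rule gives
--   Δ (n+1) k y = Δ n k y − Δ n k (y∸2),
-- and raising the exponent together with i·C(m+1,i) = (m+1)·C(m,i−1) gives
--   Δ (m+1) (k+2) y = y·Δ m (k+1) y + (2(m+1) − y)·Δ m (k+1) (y∸2).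
-- Consequently Δ (m+2) (m+1) y = R m y, where R is a triangle of natural
-- numbers with row recurrence R (m+1) y = y·R m y + (2m+6 − y)·R m (y∸2).
--
-- Finally two Pascal steps give
-- T(5+m) = A − 2B + C with A = R (m+1) (5+m), B = R (m+1) (3+m),
-- C = R (m+1) (1+m); symmetry gives C = A and monotonicity A < B, so
-- T(5+m) = 2(A − B) ≠ 0.

open import Defs
open import Data.Nat as ℕ using (ℕ; zero; suc; _∸_; _≤_; _<_; z≤n; s≤s; _/_)
import Data.Nat.Properties as ℕP
open import Data.Nat.DivMod using (m*n/n≡m; /-monoˡ-≤; m/n≤m)
open import Data.Nat.Combinatorics using (_C_; nCk+nC[k+1]≡[n+1]C[k+1]; k>n⇒nCk≡0; nC1≡n)
import Data.Nat.Tactic.RingSolver as ℕ-Solver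
open import Data.List using (map; upTo; applyUpTo)
open import Data.List.Properties using (map-applyUpTo)
open import Function using (_∘_)
open import Relation.Binary.PropositionalEquality
open import Relation.Nullary using (yes; no)

-- A triangle of natural numbers

module Triangle where

  open import Data.Nat using (_+_; _*_; _<?_; _≟_; s≤s⁻¹)
  open ℕP

  -- Row m of the triangle is supported on 0 < y < top m = 2m + 4.
  top : ℕ → ℕ
  top zero    = 4
  top (suc m) = 2 + top m

  top-double : ∀ m → top m ≡ 2 * (2 + m)
  top-double zero    = refl
  top-double (suc m) = trans (cong (2 +_) (top-double m)) (sym (*-suc 2 (2 + m)))

  4+m≤top : ∀ m → 4 + m ≤ top m
  4+m≤top zero    = ≤-refl
  4+m≤top (suc m) = s≤s (m≤n⇒m≤1+n (4+m≤top m))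

  -- m + 3 and m + 1 are mirror images about the centre m + 2 of row m.
  top-centre : ∀ m → 3 + m + (1 + m) ≡ top m
  top-centre m = trans (double m) (sym (top-double m))
    where
    double : ∀ m → 3 + m + (1 + m) ≡ 2 * (2 + m)
    double = ℕ-Solver.solve-∀

  R : ℕ → ℕ → ℕ
  R zero 1 = 1
  R zero 2 = 2
  R zero 3 = 1
  R zero _ = 0
  R (suc m) y = y * R m y + (top (suc m) ∸ y) * R m (y ∸ 2)

  -- Row m vanishes from top m on: the factor top (m+1) ∸ y kills the new term.
  R-vanish : ∀ m y → top m ≤ y → R m y ≡ 0
  R-vanish zero 0 ()
  R-vanish zero 1 (s≤s ())
  R-vanish zero 2 (s≤s (s≤s ()))
  R-vanish zero 3 (s≤s (s≤s (s≤s ())))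
  R-vanish zero (suc (suc (suc (suc y)))) _ = refl
  R-vanish (suc m) y top≤y
    rewrite R-vanish m y (≤-trans (m≤n+m (top m) 2) top≤y) | m≤n⇒m∸n≡0 top≤y =
    trans (+-identityʳ (y * 0)) (*-zeroʳ y)

  R₀-sym : ∀ y → R 0 y ≡ R 0 (4 ∸ y)
  R₀-sym 0 = refl
  R₀-sym 1 = refl
  R₀-sym 2 = refl
  R₀-sym 3 = refl
  R₀-sym 4 = refl
  R₀-sym (suc (suc (suc (suc (suc y))))) = refl

  R-sym : ∀ m y z → y + z ≡ top m → R m y ≡ R m z
  R-sym zero y z y+z≡4 =
    trans (R₀-sym y) (cong (R 0) (trans (cong (_∸ y) (sym y+z≡4)) (m+n∸m≡n y z)))
  R-sym (suc m) y z y+z≡top = begin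
    y * R m y + (top (suc m) ∸ y) * R m (y ∸ 2)  ≡⟨ cong (λ a → y * R m y + a * R m (y ∸ 2)) (complement y z y+z≡top) ⟩
    y * R m y + z * R m (y ∸ 2)                 ≡⟨ cong₂ (λ a b → y * a + z * b) (shifted y z y+z≡top) (sym (shifted z y z+y≡top)) ⟩
    y * R m (z ∸ 2) + z * R m z                 ≡⟨ +-comm (y * R m (z ∸ 2)) (z * R m z) ⟩
    z * R m z + y * R m (z ∸ 2)                 ≡⟨ cong (λ a → z * R m z + a * R m (z ∸ 2)) (sym (complement z y z+y≡top)) ⟩
    z * R m z + (top (suc m) ∸ z) * R m (z ∸ 2)  ∎
    where
    open ≡-Reasoning
    z+y≡top : z + y ≡ top (suc m)
    z+y≡top = trans (+-comm z y) y+z≡top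
    complement : ∀ y z → y + z ≡ top (suc m) → top (suc m) ∸ y ≡ z
    complement y z e = trans (cong (_∸ y) (sym e)) (m+n∸m≡n y z)
    R-at-0 : R m 0 ≡ 0
    R-at-0 = trans (R-sym m 0 (top m) refl) (R-vanish m (top m) ≤-refl)
    -- y + (z − 2) = top m, so this is the induction hypothesis; for z < 2
    -- the argument y is beyond the support of row m and both sides vanish
    shifted : ∀ y z → y + z ≡ top (suc m) → R m y ≡ R m (z ∸ 2)
    shifted y 0 e =
      trans (R-vanish m y (≤-trans (m≤n+m (top m) 2) (≤-reflexive (trans (sym e) (+-identityʳ y)))))
            (sym R-at-0)
    shifted y 1 e =
      trans (R-vanish m y (≤-trans (n≤1+n (top m)) (≤-reflexive (sym (suc-injective (trans (+-comm 1 y) e))))))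
            (sym R-at-0)
    shifted y (suc (suc z)) e =
      R-sym m y z (suc-injective (suc-injective (trans (sym (trans (+-suc y (suc z)) (cong suc (+-suc y z)))) e)))

  positive-product : ∀ {x a} → 0 < x → 0 < a → 0 < x * a
  positive-product {suc x} {suc a} _ _ = s≤s z≤n

  R-decreasing : ∀ m y → 2 + m ≤ y → y < top m → R m (2 + y) < R m y
  R-antitone   : ∀ m y → 1 + m ≤ y → R m (2 + y) ≤ R m y
  step-inside  : ∀ m w → suc m ≤ w → 2 + w < top m → R (suc m) (4 + w) < R (suc m) (2 + w)
  step-outside : ∀ m w → suc m ≤ w → 2 + w < top (suc m) → top m ≤ 2 + w →
                 R (suc m) (4 + w) < R (suc m) (2 + w)

  R-decreasing zero 0 () _
  R-decreasing zero 1 (s≤s ()) _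
  R-decreasing zero 2 _ _ = s≤s z≤n
  R-decreasing zero 3 _ _ = s≤s z≤n
  R-decreasing zero (suc (suc (suc (suc y)))) _ (s≤s (s≤s (s≤s (s≤s ()))))
  R-decreasing (suc m) 0 () _
  R-decreasing (suc m) 1 (s≤s ()) _
  R-decreasing (suc m) (suc (suc w)) (s≤s (s≤s m<w)) 2+w<top with 2 + w <? top m
  ... | yes inside  = step-inside m w m<w inside
  ... | no  outside = step-outside m w m<w 2+w<top (≮⇒≥ outside)

  R-antitone m y m<y with y <? top m
  ... | no outside = subst (_≤ R m y) (sym (R-vanish m (2 + y) (≤-trans (≮⇒≥ outside) (m≤n+m y 2)))) z≤n
  ... | yes inside with y ≟ suc m
  ...   | yes refl  = ≤-reflexive (R-sym m (3 + m) (1 + m) (top-centre m))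
  ...   | no  y≢1+m = <⇒≤ (R-decreasing m y (≤∧≢⇒< m<y (y≢1+m ∘ sym)) inside)

  step-inside m w m<w inside = begin-strict
    (4 + w) * d + (top m ∸ (2 + w)) * c  <⟨ +-monoˡ-< _ (*-monoʳ-< (4 + w) (R-decreasing m (2 + w) (s≤s (s≤s (<⇒≤ m<w))) inside)) ⟩
    (4 + w) * c + (top m ∸ (2 + w)) * c  ≡⟨ regroup w c (top m ∸ (2 + w)) ⟩
    (2 + w) * c + (2 + (top m ∸ (2 + w))) * c ≡⟨ cong (λ t → (2 + w) * c + t * c) (sym (+-∸-assoc 2 (<⇒≤ inside))) ⟩
    (2 + w) * c + (top m ∸ w) * c        ≤⟨ +-monoʳ-≤ ((2 + w) * c) (*-monoʳ-≤ (top m ∸ w) (R-antitone m w m<w)) ⟩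
    (2 + w) * c + (top m ∸ w) * a        ∎
    where
    open ≤-Reasoning
    a = R m w
    c = R m (2 + w)
    d = R m (4 + w)
    regroup : ∀ w c t → (4 + w) * c + t * c ≡ (2 + w) * c + (2 + t) * c
    regroup = ℕ-Solver.solve-∀

  step-outside m w m<w 2+w<top top≤2+w = begin-strict
    (4 + w) * d + (top m ∸ (2 + w)) * c  ≡⟨ cong₂ (λ p q → (4 + w) * p + (top m ∸ (2 + w)) * q) d≡0 c≡0 ⟩
    (4 + w) * 0 + (top m ∸ (2 + w)) * 0  ≡⟨ cong₂ _+_ (*-zeroʳ (4 + w)) (*-zeroʳ (top m ∸ (2 + w))) ⟩
    0                                    <⟨ positive-product (m<n⇒0<n∸m w<top) a>0 ⟩
    (top m ∸ w) * a                      ≤⟨ m≤n+m _ ((2 + w) * c) ⟩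
    (2 + w) * c + (top m ∸ w) * a        ∎
    where
    open ≤-Reasoning
    a = R m w
    c = R m (2 + w)
    d = R m (4 + w)
    c≡0 : c ≡ 0
    c≡0 = R-vanish m (2 + w) top≤2+w
    d≡0 : d ≡ 0
    d≡0 = R-vanish m (4 + w) (≤-trans top≤2+w (m≤n+m (2 + w) 2))
    w<top : w < top m
    w<top = s≤s⁻¹ (s≤s⁻¹ 2+w<top)
    -- w lies in the upper half of the previous row, where it is positive
    a>0 : 0 < a
    a>0 = ≤-<-trans z≤n (R-decreasing m w (s≤s⁻¹ (s≤s⁻¹ (≤-trans (4+m≤top m) top≤2+w))) w<top)

open Triangle

open import Data.Integer using (ℤ; +_; -_; _+_; _-_; _*_; _^_)
import Data.Integer.Properties as ℤP
open import Data.Integer.Tactic.RingSolver using (solve-∀)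

-- Finite sums of integers

∑ : ℕ → (ℕ → ℤ) → ℤ
∑ zero    f = + 0
∑ (suc n) f = f 0 + ∑ n (f ∘ suc)

sumℤ-upTo : ∀ f n → sumℤ (map f (upTo n)) ≡ ∑ n f
sumℤ-upTo f n = trans (cong sumℤ (map-applyUpTo (λ i → i) f n)) (sum-applyUpTo f n)
  where
  sum-applyUpTo : ∀ f n → sumℤ (applyUpTo f n) ≡ ∑ n f
  sum-applyUpTo f zero    = refl
  sum-applyUpTo f (suc n) = cong (_+_ (f 0)) (sum-applyUpTo (f ∘ suc) n)

∑-cong : ∀ n {f g : ℕ → ℤ} → (∀ i → f i ≡ g i) → ∑ n f ≡ ∑ n g
∑-cong zero    f≗g = refl
∑-cong (suc n) f≗g = cong₂ _+_ (f≗g 0) (∑-cong n (f≗g ∘ suc))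

∑-last : ∀ n f → ∑ (suc n) f ≡ ∑ n f + f n
∑-last zero    f = ℤP.+-comm (f 0) (+ 0)
∑-last (suc n) f = trans (cong (_+_ (f 0)) (∑-last n (f ∘ suc))) (sym (ℤP.+-assoc (f 0) _ _))

∑-+ : ∀ n f g → ∑ n (λ i → f i + g i) ≡ ∑ n f + ∑ n g
∑-+ zero    f g = refl
∑-+ (suc n) f g =
  trans (cong (_+_ (f 0 + g 0)) (∑-+ n (f ∘ suc) (g ∘ suc))) (interchange (f 0) (g 0) _ _)
  where
  interchange : ∀ a b c d → (a + b) + (c + d) ≡ (a + c) + (b + d)
  interchange = solve-∀

∑-scale : ∀ n c f → ∑ n (λ i → c * f i) ≡ c * ∑ n f
∑-scale zero    c f = sym (ℤP.*-zeroʳ c)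
∑-scale (suc n) c f =
  trans (cong (_+_ (c * f 0)) (∑-scale n c (f ∘ suc))) (sym (ℤP.*-distribˡ-+ c (f 0) _))

∑-extend : ∀ a d f → (∀ i → a ≤ i → f i ≡ + 0) → ∑ (a ℕ.+ d) f ≡ ∑ a f
∑-extend a zero    f vanish = cong (λ n → ∑ n f) (ℕP.+-identityʳ a)
∑-extend a (suc d) f vanish = begin
  ∑ (a ℕ.+ suc d) f          ≡⟨ cong (λ n → ∑ n f) (ℕP.+-suc a d) ⟩
  ∑ (suc (a ℕ.+ d)) f        ≡⟨ ∑-last (a ℕ.+ d) f ⟩
  ∑ (a ℕ.+ d) f + f (a ℕ.+ d) ≡⟨ cong₂ _+_ (∑-extend a d f vanish) (vanish _ (ℕP.m≤m+n a d)) ⟩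
  ∑ a f + + 0                ≡⟨ ℤP.+-identityʳ _ ⟩
  ∑ a f                      ∎
  where open ≡-Reasoning

absorption : ∀ m j → suc j ℕ.* (suc m C suc j) ≡ suc m ℕ.* (m C j)
absorption zero    zero    = refl
absorption zero    (suc j) = ℕP.*-zeroʳ (suc (suc j))
absorption (suc m) zero    =
  trans (ℕP.+-identityʳ _) (trans (nC1≡n (suc (suc m))) (sym (ℕP.*-identityʳ (suc (suc m)))))
absorption (suc m) (suc j) = begin
  suc j′ ℕ.* (suc m′ C suc j′)
    ≡⟨ cong (suc j′ ℕ.*_) (sym (nCk+nC[k+1]≡[n+1]C[k+1] m′ j′)) ⟩
  suc j′ ℕ.* (m′ C j′ ℕ.+ m′ C suc j′)
    ≡⟨ ℕP.*-distribˡ-+ (suc j′) (m′ C j′) (m′ C suc j′) ⟩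
  (m′ C j′ ℕ.+ j′ ℕ.* (m′ C j′)) ℕ.+ suc j′ ℕ.* (m′ C suc j′)
    ≡⟨ cong₂ (λ a b → (m′ C j′ ℕ.+ a) ℕ.+ b) (absorption m j) (absorption m j′) ⟩
  (m′ C j′ ℕ.+ m′ ℕ.* (m C j)) ℕ.+ m′ ℕ.* (m C j′)
    ≡⟨ ℕP.+-assoc (m′ C j′) _ _ ⟩
  m′ C j′ ℕ.+ (m′ ℕ.* (m C j) ℕ.+ m′ ℕ.* (m C j′))
    ≡⟨ cong (m′ C j′ ℕ.+_) (sym (ℕP.*-distribˡ-+ m′ (m C j) (m C j′))) ⟩
  m′ C j′ ℕ.+ m′ ℕ.* (m C j ℕ.+ m C j′)
    ≡⟨ cong (λ c → m′ C j′ ℕ.+ m′ ℕ.* c) (nCk+nC[k+1]≡[n+1]C[k+1] m j) ⟩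
  suc m′ ℕ.* (m′ C j′) ∎
  where
  open ≡-Reasoning
  m′ = suc m
  j′ = suc j

pos-∸ : ∀ {m n} → n ≤ m → + (m ∸ n) ≡ + m - + n
pos-∸ {m} {n} n≤m = sym (trans (ℤP.[+m]-[+n]≡m⊖n m n) (ℤP.⊖-≥ n≤m))

-- A power of exponent ≥ 1 of a truncated difference can be peeled off by the
-- true difference: if j > y both sides vanish.
peel-power : ∀ y j k → (+ (y ∸ j)) ^ suc (suc k) ≡ (+ y - + j) * (+ (y ∸ j)) ^ suc k
peel-power y j k with j ℕ.≤? y
... | yes j≤y = cong (λ d → d * (+ (y ∸ j)) ^ suc k) (pos-∸ j≤y)
... | no  j≰y rewrite ℕP.m≤n⇒m∸n≡0 (ℕP.<⇒≤ (ℕP.≰⇒> j≰y)) = sym (ℤP.*-zeroʳ (+ y - + j))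

∸-twice-suc : ∀ y i → y ∸ 2 ℕ.* suc i ≡ (y ∸ 2) ∸ 2 ℕ.* i
∸-twice-suc y i = trans (cong (y ∸_) (ℕP.*-suc 2 i)) (sym (ℕP.∸-+-assoc y 2 (2 ℕ.* i)))

-- Differences of step 2 of truncated powers

-- δ n k y i = (-1)^i (y ∸ 2i)^k C(n,i); for n = y = b and k = b − 3 these are
-- exactly the terms of T(b).
δ : ℕ → ℕ → ℕ → ℕ → ℤ
δ n k y i = sign i * (+ (y ∸ 2 ℕ.* i)) ^ k * + (n C i)

Δ : ℕ → ℕ → ℕ → ℤ
Δ n k y = ∑ (suc n) (δ n k y)

-- Pascal's rule C(n+1,i+1) = C(n,i) + C(n,i+1), term by term.
δ-pascal : ∀ n k y i →
           δ (suc n) k y (suc i) ≡ - (+ 1) * δ n k (y ∸ 2) i + δ n k y (suc i)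
δ-pascal n k y i = begin
  sign (suc i) * p * + (suc n C suc i)
    ≡⟨ cong (λ c → sign (suc i) * p * c) binomial ⟩
  (- (+ 1) * sign i) * p * (+ (n C i) + + (n C suc i))
    ≡⟨ split (sign i) p _ _ ⟩
  - (+ 1) * (sign i * p * + (n C i)) + sign (suc i) * p * + (n C suc i)
    ≡⟨ cong (λ d → - (+ 1) * (sign i * (+ d) ^ k * + (n C i)) + δ n k y (suc i)) (∸-twice-suc y i) ⟩
  - (+ 1) * δ n k (y ∸ 2) i + δ n k y (suc i) ∎
  where
  open ≡-Reasoning
  p = (+ (y ∸ 2 ℕ.* suc i)) ^ k
  binomial : + (suc n C suc i) ≡ + (n C i) + + (n C suc i)
  binomial = trans (cong +_ (sym (nCk+nC[k+1]≡[n+1]C[k+1] n i))) (ℤP.pos-+ (n C i) (n C suc i))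
  split : ∀ s p a b → (- (+ 1) * s) * p * (a + b) ≡ - (+ 1) * (s * p * a) + (- (+ 1) * s) * p * b
  split = solve-∀

Δ-pascal : ∀ n k y → Δ (suc n) k y ≡ Δ n k y - Δ n k (y ∸ 2)
Δ-pascal n k y = begin
  δ n k y 0 + ∑ (suc n) (λ i → δ (suc n) k y (suc i))
    ≡⟨ cong (_+_ (δ n k y 0)) (∑-cong (suc n) (δ-pascal n k y)) ⟩
  δ n k y 0 + ∑ (suc n) (λ i → - (+ 1) * δ n k (y ∸ 2) i + δ n k y (suc i))
    ≡⟨ cong (_+_ (δ n k y 0)) (∑-+ (suc n) (λ i → - (+ 1) * δ n k (y ∸ 2) i) (δ n k y ∘ suc)) ⟩
  δ n k y 0 + (∑ (suc n) (λ i → - (+ 1) * δ n k (y ∸ 2) i) + ∑ (suc n) (δ n k y ∘ suc))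
    ≡⟨ cong₂ (λ a b → δ n k y 0 + (a + b)) (∑-scale (suc n) (- (+ 1)) (δ n k (y ∸ 2))) top-term-vanishes ⟩
  δ n k y 0 + (- (+ 1) * Δ n k (y ∸ 2) + ∑ n (δ n k y ∘ suc))
    ≡⟨ rearrange (δ n k y 0) _ _ ⟩
  Δ n k y - Δ n k (y ∸ 2) ∎
  where
  open ≡-Reasoning
  -- the summand i = n+1 carries the factor C(n, n+1) = 0
  top-term : δ n k y (suc n) ≡ + 0
  top-term = trans (cong (λ c → sign (suc n) * (+ (y ∸ 2 ℕ.* suc n)) ^ k * + c) (k>n⇒nCk≡0 (ℕP.n<1+n n)))
                   (ℤP.*-zeroʳ (sign (suc n) * (+ (y ∸ 2 ℕ.* suc n)) ^ k))
  top-term-vanishes : ∑ (suc n) (δ n k y ∘ suc) ≡ ∑ n (δ n k y ∘ suc)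
  top-term-vanishes = begin
    ∑ (suc n) (δ n k y ∘ suc)               ≡⟨ ∑-last n (δ n k y ∘ suc) ⟩
    ∑ n (δ n k y ∘ suc) + δ n k y (suc n)   ≡⟨ cong (_+_ (∑ n (δ n k y ∘ suc))) top-term ⟩
    ∑ n (δ n k y ∘ suc) + + 0               ≡⟨ ℤP.+-identityʳ _ ⟩
    ∑ n (δ n k y ∘ suc)                     ∎
  rearrange : ∀ a b c → a + (- (+ 1) * b + c) ≡ (a + c) - b
  rearrange = solve-∀

Δ-second : ∀ n k y →
           Δ (suc (suc n)) k y ≡ (Δ n k y - Δ n k (y ∸ 2)) - (Δ n k (y ∸ 2) - Δ n k (y ∸ 2 ∸ 2))
Δ-second n k y = trans (Δ-pascal (suc n) k y) (cong₂ _-_ (Δ-pascal n k y) (Δ-pascal n k (y ∸ 2)))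

-- Raising the exponent: (y ∸ 2i)^{k+2} = (y − 2i)(y ∸ 2i)^{k+1}, term by term.
δ-raise : ∀ n k y i →
          δ n (suc (suc k)) y i ≡ + y * δ n (suc k) y i + - (+ 1) * (+ (2 ℕ.* i) * δ n (suc k) y i)
δ-raise n k y i =
  trans (cong (λ q → sign i * q * + (n C i)) (peel-power y (2 ℕ.* i) k))
        (distribute (sign i) (+ y) (+ (2 ℕ.* i)) _ _)
  where
  distribute : ∀ s y t q c → s * ((y - t) * q) * c ≡ y * (s * q * c) + - (+ 1) * (t * (s * q * c))
  distribute = solve-∀

-- The weight 2i is absorbed by the binomial coefficient:
-- Σ_i 2i·δ (m+1) k y i = −2(m+1)·Δ m k (y ∸ 2).
Δ-weighted : ∀ m k y →
             ∑ (suc (suc m)) (λ i → + (2 ℕ.* i) * δ (suc m) k y i) ≡ - (+ 2 * + suc m) * Δ m k (y ∸ 2)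
Δ-weighted m k y = begin
  + 0 + ∑ (suc m) (λ i → + (2 ℕ.* suc i) * δ (suc m) k y (suc i))
    ≡⟨ ℤP.+-identityˡ _ ⟩
  ∑ (suc m) (λ i → + (2 ℕ.* suc i) * δ (suc m) k y (suc i))
    ≡⟨ ∑-cong (suc m) weighted-term ⟩
  ∑ (suc m) (λ i → - (+ 2 * + suc m) * δ m k (y ∸ 2) i)
    ≡⟨ ∑-scale (suc m) (- (+ 2 * + suc m)) (δ m k (y ∸ 2)) ⟩
  - (+ 2 * + suc m) * Δ m k (y ∸ 2) ∎
  where
  open ≡-Reasoning
  weighted-term : ∀ i → + (2 ℕ.* suc i) * δ (suc m) k y (suc i) ≡ - (+ 2 * + suc m) * δ m k (y ∸ 2) i
  weighted-term i = begin
    + (2 ℕ.* suc i) * (sign (suc i) * p * + (suc m C suc i))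
      ≡⟨ cong (λ t → t * (sign (suc i) * p * + (suc m C suc i))) (ℤP.pos-* 2 (suc i)) ⟩
    (+ 2 * + suc i) * ((- (+ 1) * sign i) * p * + (suc m C suc i))
      ≡⟨ gather (sign i) p (+ suc i) _ ⟩
    - (+ 2) * (sign i * p * (+ suc i * + (suc m C suc i)))
      ≡⟨ cong (λ t → - (+ 2) * (sign i * p * t)) absorbed ⟩
    - (+ 2) * (sign i * p * (+ suc m * + (m C i)))
      ≡⟨ scatter (sign i) p (+ suc m) _ ⟩
    - (+ 2 * + suc m) * (sign i * p * + (m C i))
      ≡⟨ cong (λ d → - (+ 2 * + suc m) * (sign i * (+ d) ^ k * + (m C i))) (∸-twice-suc y i) ⟩
    - (+ 2 * + suc m) * δ m k (y ∸ 2) i ∎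
    where
    p = (+ (y ∸ 2 ℕ.* suc i)) ^ k
    absorbed : + suc i * + (suc m C suc i) ≡ + suc m * + (m C i)
    absorbed = trans (sym (ℤP.pos-* (suc i) _)) (trans (cong +_ (absorption m i)) (ℤP.pos-* (suc m) _))
    gather : ∀ s p a b → (+ 2 * a) * ((- (+ 1) * s) * p * b) ≡ - (+ 2) * (s * p * (a * b))
    gather = solve-∀
    scatter : ∀ s p c d → - (+ 2) * (s * p * (c * d)) ≡ - (+ 2 * c) * (s * p * d)
    scatter = solve-∀

Δ-raise : ∀ m k y →
          Δ (suc m) (suc (suc k)) y
            ≡ + y * Δ m (suc k) y + (+ 2 * + suc m - + y) * Δ m (suc k) (y ∸ 2)
Δ-raise m k y = begin
  ∑ (suc (suc m)) (δ (suc m) (suc (suc k)) y)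
    ≡⟨ ∑-cong (suc (suc m)) (δ-raise (suc m) k y) ⟩
  ∑ (suc (suc m)) (λ i → + y * δ₁ i + - (+ 1) * (+ (2 ℕ.* i) * δ₁ i))
    ≡⟨ ∑-+ (suc (suc m)) (λ i → + y * δ₁ i) (λ i → - (+ 1) * (+ (2 ℕ.* i) * δ₁ i)) ⟩
  ∑ (suc (suc m)) (λ i → + y * δ₁ i) + ∑ (suc (suc m)) (λ i → - (+ 1) * (+ (2 ℕ.* i) * δ₁ i))
    ≡⟨ cong₂ _+_ (∑-scale (suc (suc m)) (+ y) δ₁) (∑-scale (suc (suc m)) (- (+ 1)) (λ i → + (2 ℕ.* i) * δ₁ i)) ⟩
  + y * Δ (suc m) (suc k) y + - (+ 1) * ∑ (suc (suc m)) (λ i → + (2 ℕ.* i) * δ₁ i)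
    ≡⟨ cong₂ (λ a b → + y * a + - (+ 1) * b) (Δ-pascal m (suc k) y) (Δ-weighted m (suc k) y) ⟩
  + y * (Δ m (suc k) y - Δ m (suc k) (y ∸ 2)) + - (+ 1) * (- (+ 2 * + suc m) * Δ m (suc k) (y ∸ 2))
    ≡⟨ collect (+ y) _ _ (+ suc m) ⟩
  + y * Δ m (suc k) y + (+ 2 * + suc m - + y) * Δ m (suc k) (y ∸ 2) ∎
  where
  open ≡-Reasoning
  δ₁ = δ (suc m) (suc k) y
  collect : ∀ y a b c → y * (a - b) + - (+ 1) * (- (+ 2 * c) * b) ≡ y * a + (+ 2 * c - y) * b
  collect = solve-∀

-- The triangle R is a diagonal of the differences Δ

-- Row 0: y − 2(y ∸ 2) + (y ∸ 4) is 0, 1, 2, 1, 0, 0, ….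
Δ-row-0 : ∀ y → Δ 2 1 y ≡ + R 0 y
Δ-row-0 0 = refl
Δ-row-0 1 = refl
Δ-row-0 2 = refl
Δ-row-0 3 = refl
Δ-row-0 (suc (suc (suc (suc y)))) = linear-cancels (+ y)
  where
  linear-cancels : ∀ x → (- (+ 1)) ^ 0 * ((+ 4 + x) * + 1) * + 1
                         + ((- (+ 1)) ^ 1 * ((+ 2 + x) * + 1) * + 2 + ((- (+ 1)) ^ 2 * (x * + 1) * + 1 + + 0))
                         ≡ + 0
  linear-cancels = solve-∀

-- Δ (m+2) (m+1) y = R m y: the second recurrence for Δ is the row
-- recurrence of R, whose coefficient 2m+6 − y is only needed for y ≤ 2m+6.
Δ-triangle : ∀ m y → Δ (suc (suc m)) (suc m) y ≡ + R m y
Δ-triangle zero    y = Δ-row-0 y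
Δ-triangle (suc m) y = begin
  Δ (3 ℕ.+ m) (2 ℕ.+ m) y
    ≡⟨ Δ-raise (2 ℕ.+ m) m y ⟩
  + y * Δ (2 ℕ.+ m) (1 ℕ.+ m) y + (+ 2 * + (3 ℕ.+ m) - + y) * Δ (2 ℕ.+ m) (1 ℕ.+ m) (y ∸ 2)
    ≡⟨ cong₂ (λ a b → + y * a + (+ 2 * + (3 ℕ.+ m) - + y) * b) (Δ-triangle m y) (Δ-triangle m (y ∸ 2)) ⟩
  + y * + R m y + (+ 2 * + (3 ℕ.+ m) - + y) * + R m (y ∸ 2)
    ≡⟨ cong (_+_ (+ y * + R m y)) coefficient ⟩
  + y * + R m y + + (top (suc m) ∸ y) * + R m (y ∸ 2)
    ≡⟨ sym (cong₂ _+_ (ℤP.pos-* y (R m y)) (ℤP.pos-* (top (suc m) ∸ y) (R m (y ∸ 2)))) ⟩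
  + (y ℕ.* R m y) + + ((top (suc m) ∸ y) ℕ.* R m (y ∸ 2))
    ≡⟨ sym (ℤP.pos-+ (y ℕ.* R m y) _) ⟩
  + R (suc m) y ∎
  where
  open ≡-Reasoning
  2[3+m]≡top : + 2 * + (3 ℕ.+ m) ≡ + top (suc m)
  2[3+m]≡top = trans (sym (ℤP.pos-* 2 (3 ℕ.+ m))) (cong +_ (sym (top-double (suc m))))
  -- 2(m+3) − y may be negative, but then R m (y ∸ 2) = 0
  coefficient : (+ 2 * + (3 ℕ.+ m) - + y) * + R m (y ∸ 2) ≡ + (top (suc m) ∸ y) * + R m (y ∸ 2)
  coefficient with y ℕ.≤? top (suc m)
  ... | yes y≤top =
    trans (cong (λ t → (t - + y) * + R m (y ∸ 2)) 2[3+m]≡top) (cong (_* + R m (y ∸ 2)) (sym (pos-∸ y≤top)))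
  ... | no  y≰top rewrite R-vanish m (y ∸ 2) (ℕP.≤-trans (ℕP.n≤1+n (top m)) (ℕP.∸-monoˡ-≤ 2 (ℕP.≰⇒> y≰top))) =
    trans (ℤP.*-zeroʳ (+ 2 * + (3 ℕ.+ m) - + y)) (sym (ℤP.*-zeroʳ (+ (top (suc m) ∸ y))))

half-bound : ∀ b i → b / 2 < i → b ∸ 2 ℕ.* i ≡ 0
half-bound b i b/2<i = ℕP.m≤n⇒m∸n≡0 (ℕP.≮⇒≥ λ 2i<b → ℕP.<⇒≱ b/2<i (i≤b/2 2i<b))
  where
  i≤b/2 : 2 ℕ.* i < b → i ≤ b / 2
  i≤b/2 2i<b = ℕP.≤-trans (ℕP.≤-reflexive (sym (m*n/n≡m i 2)))
                           (/-monoˡ-≤ 2 (ℕP.≤-trans (ℕP.≤-reflexive (ℕP.*-comm i 2)) (ℕP.<⇒≤ 2i<b)))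

-- For b ≥ 4 the exponent b − 3 is positive, so the omitted terms vanish.
T-as-Δ : ∀ m → T (4 ℕ.+ m) ≡ Δ (4 ℕ.+ m) (suc m) (4 ℕ.+ m)
T-as-Δ m = begin
  T b                                  ≡⟨ sumℤ-upTo (δ b k b) (suc (b / 2)) ⟩
  ∑ (suc (b / 2)) (δ b k b)            ≡⟨ sym (∑-extend (suc (b / 2)) (b ∸ b / 2) (δ b k b) beyond-half) ⟩
  ∑ (suc (b / 2) ℕ.+ (b ∸ b / 2)) (δ b k b) ≡⟨ cong (λ n → ∑ (suc n) (δ b k b)) (ℕP.m+[n∸m]≡n (m/n≤m b 2)) ⟩
  Δ b k b                              ∎
  where
  open ≡-Reasoning
  b = 4 ℕ.+ m
  k = suc m
  beyond-half : ∀ i → suc (b / 2) ≤ i → δ b k b i ≡ + 0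
  beyond-half i b/2<i rewrite half-bound b i b/2<i = cong (_* + (b C i)) (ℤP.*-zeroʳ (sign i))

T-closed-form : ∀ m → let A = R (suc m) (5 ℕ.+ m); B = R (suc m) (3 ℕ.+ m) in
                T (5 ℕ.+ m) ≡ (+ A - + B) - (+ B - + A)
T-closed-form m = begin
  T (5 ℕ.+ m)                 ≡⟨ T-as-Δ (suc m) ⟩
  Δ (5 ℕ.+ m) (2 ℕ.+ m) (5 ℕ.+ m) ≡⟨ Δ-second (3 ℕ.+ m) (2 ℕ.+ m) (5 ℕ.+ m) ⟩
  (Δ₃ (5 ℕ.+ m) - Δ₃ (3 ℕ.+ m)) - (Δ₃ (3 ℕ.+ m) - Δ₃ (1 ℕ.+ m))
    ≡⟨ cong₂ _-_ (cong₂ _-_ (Δ-triangle (suc m) (5 ℕ.+ m)) (Δ-triangle (suc m) (3 ℕ.+ m)))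
                 (cong₂ _-_ (Δ-triangle (suc m) (3 ℕ.+ m)) (Δ-triangle (suc m) (1 ℕ.+ m))) ⟩
  (+ A - + B) - (+ B - + R (suc m) (1 ℕ.+ m))
    ≡⟨ cong (λ c → (+ A - + B) - (+ B - + c)) (sym (R-sym (suc m) (5 ℕ.+ m) (1 ℕ.+ m) mirror)) ⟩
  (+ A - + B) - (+ B - + A) ∎
  where
  open ≡-Reasoning
  Δ₃ = Δ (3 ℕ.+ m) (2 ℕ.+ m)
  A = R (suc m) (5 ℕ.+ m)
  B = R (suc m) (3 ℕ.+ m)
  mirror : 5 ℕ.+ m ℕ.+ (1 ℕ.+ m) ≡ top (suc m)
  mirror = trans (double-3+m m) (sym (top-double (suc m)))
    where
    double-3+m : ∀ m → 5 ℕ.+ m ℕ.+ (1 ℕ.+ m) ≡ 2 ℕ.* (3 ℕ.+ m)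
    double-3+m = ℕ-Solver.solve-∀

twice-difference-nonzero : ∀ {a b} → a < b → (+ a - + b) - (+ b - + a) ≢ + 0
twice-difference-nonzero {a} {b} a<b twice≡0 = ℕP.<-irrefl a+a≡b+b (ℕP.+-mono-< a<b a<b)
  where
  open ≡-Reasoning
  rearrange : ∀ x y → x + x ≡ (y + y) + ((x - y) - (y - x))
  rearrange = solve-∀
  a+a≡b+b : a ℕ.+ a ≡ b ℕ.+ b
  a+a≡b+b = ℤP.+-injective (begin
    + (a ℕ.+ a)                                 ≡⟨ ℤP.pos-+ a a ⟩
    + a + + a                                   ≡⟨ rearrange (+ a) (+ b) ⟩
    (+ b + + b) + ((+ a - + b) - (+ b - + a))   ≡⟨ cong (_+_ (+ b + + b)) twice≡0 ⟩
    (+ b + + b) + + 0                           ≡⟨ ℤP.+-identityʳ _ ⟩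
    + b + + b                                   ≡⟨ sym (ℤP.pos-+ b b) ⟩
    + (b ℕ.+ b)                                 ∎)

mainTheorem12 : (b : ℕ) → 5 ≤ b → T b ≢ + 0
mainTheorem12 (suc (suc (suc (suc (suc m))))) _ T≡0 =
  twice-difference-nonzero A<B (trans (sym (T-closed-form m)) T≡0)
  where
  -- 3 + m lies in the upper half of row m + 1
  A<B : R (suc m) (5 ℕ.+ m) < R (suc m) (3 ℕ.+ m)
  A<B = R-decreasing (suc m) (3 ℕ.+ m) ℕP.≤-refl (ℕP.≤-trans (ℕP.n≤1+n _) (4+m≤top (suc m)))
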